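{- For every integer $k\geq0$, $$t^{2k+1}+\sum_{i=0}^k\frac{2k+1}{2i+1}\binom{k+i}{2i}t^{k-i}(1-t)^{2i+1}=1.$$
   Context: This is an identity of polynomials in the variable $t$. -}

module Defs where

open import Data.Nat using (ℕ; zero; suc)
open import Data.Rational using (ℚ; 0ℚ; 1ℚ; _+_; _*_)

_^ℚ_ : ℚ → ℕ → ℚ
t ^ℚ zero  = 1ℚ
t ^ℚ suc n = t * (t ^ℚ n)

sumTo : ℕ → (ℕ → ℚ) → ℚ
sumTo zero    f = f 0
sumTo (suc k) f = sumTo k f + f (suc k)

-- Put s = 1 - t and u = s².  The weight (2k+1)/(2i+1) C(k+i,2i) is the integer
-- C(k+i,2i) + 2 C(k+i,2i+1), so the sum is s (E_k + 2 B_k), where E_k, B_k and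
-- O_k are the homogeneous sums  Σ_i c_i t^(k-i) u^i  with coefficients C(k+i,2i),
-- C(k+i,2i+1) and C(k+1+i,2i+1).  Pascal's rule gives
--   E_(k+1) = t E_k + u O_k,   O_(k+1) = t O_k + E_(k+1),   B_(k+1) = t O_k,
-- and because u = (1-t)² this recurrence has eigenvalues 1 and t²: in fact
-- O_k = 1 + t² + ... + t^(2k) and E_k = O_k - t O_(k-1).  Hence
-- E_k + 2 B_k = 1 + t + ... + t^(2k), and the theorem is the telescoping
-- t^(2k+1) + (1 - t)(1 + t + ... + t^(2k)) = 1.

module Submission where

open import Defs
open import Data.Nat using (ℕ; zero; suc; _∸_; _≤_; z≤n; s≤s) renaming (_+_ to _+ℕ_; _*_ to _*ℕ_)
import Data.Nat.Properties as ℕ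
open import Data.Nat.Combinatorics using (_C_; nCk+nC[k+1]≡[n+1]C[k+1]; k>n⇒nCk≡0; nC1≡n)
import Data.Nat.Tactic.RingSolver as ℕ-Solver
open import Data.Integer using (+_) renaming (_+_ to _+ℤ_; _*_ to _*ℤ_)
import Data.Integer.Properties as ℤ
open import Data.Rational using (ℚ; 0ℚ; 1ℚ; _+_; _*_; _-_; _/_; toℚᵘ)
import Data.Rational.Properties as ℚ
open import Data.Rational.Properties using (toℚᵘ-injective; toℚᵘ-fromℚᵘ; toℚᵘ-homo-*; toℚᵘ-homo-+; +-*-commutativeRing; _≟_)
open import Data.Rational.Unnormalised using (mkℚᵘ; *≡*) renaming (_≃_ to _≃ᵘ_; _*_ to _*ᵘ_; _+_ to _+ᵘ_)
import Data.Rational.Unnormalised.Properties as ℚᵘ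
open import Level using (0ℓ)
open import Relation.Nullary.Decidable using (dec⇒maybe)
open import Relation.Binary.PropositionalEquality
open import Tactic.RingSolver using (solve-∀)
import Tactic.RingSolver.Core.AlmostCommutativeRing as ACR

absorption : ∀ n r → suc r *ℕ (suc n C suc r) ≡ suc n *ℕ (n C r)
absorption zero    zero    = refl
absorption zero    (suc r) = ℕ.*-zeroʳ (suc (suc r))
absorption (suc n) zero    = trans (ℕ.*-identityˡ _) (trans (nC1≡n (suc (suc n))) (sym (ℕ.*-identityʳ (suc (suc n)))))
absorption (suc n) (suc r) = begin
  suc (suc r) *ℕ (suc (suc n) C suc (suc r))
    ≡⟨ cong (suc (suc r) *ℕ_) (nCk+nC[k+1]≡[n+1]C[k+1] (suc n) (suc r)) ⟨
  suc (suc r) *ℕ (X +ℕ Y)                    ≡⟨ split r X Y ⟩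
  suc r *ℕ X +ℕ suc (suc r) *ℕ Y +ℕ X
    ≡⟨ cong₂ (λ a b → a +ℕ b +ℕ X) (absorption n r) (absorption n (suc r)) ⟩
  suc n *ℕ (n C r) +ℕ suc n *ℕ (n C suc r) +ℕ X
    ≡⟨ cong (_+ℕ X) (ℕ.*-distribˡ-+ (suc n) (n C r) (n C suc r)) ⟨
  suc n *ℕ (n C r +ℕ n C suc r) +ℕ X
    ≡⟨ cong (λ a → suc n *ℕ a +ℕ X) (nCk+nC[k+1]≡[n+1]C[k+1] n r) ⟩
  suc n *ℕ X +ℕ X                            ≡⟨ ℕ.+-comm (suc n *ℕ X) X ⟩
  suc (suc n) *ℕ X                           ∎
  where
  X = suc n C suc r
  Y = suc n C suc (suc r)
  split : ∀ r X Y → suc (suc r) *ℕ (X +ℕ Y) ≡ suc r *ℕ X +ℕ suc (suc r) *ℕ Y +ℕ X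
  split = ℕ-Solver.solve-∀
  open ≡-Reasoning

evenBinom oddBinom : ℕ → ℕ → ℕ
evenBinom k i = (k +ℕ i) C (2 *ℕ i)
oddBinom  k i = (k +ℕ i) C suc (2 *ℕ i)

evenBinom-vanish : ∀ k → evenBinom k (suc k) ≡ 0
evenBinom-vanish k = k>n⇒nCk≡0 (ℕ.≤-reflexive (cong (λ z → suc (k +ℕ suc z)) (sym (ℕ.+-identityʳ k))))

oddBinom-vanish : ∀ k → oddBinom k k ≡ 0
oddBinom-vanish k = k>n⇒nCk≡0 (s≤s (ℕ.≤-reflexive (cong (k +ℕ_) (sym (ℕ.+-identityʳ k)))))

oddBinom-pascal : ∀ k i → oddBinom (suc k) i ≡ evenBinom k i +ℕ oddBinom k i
oddBinom-pascal k i = sym (nCk+nC[k+1]≡[n+1]C[k+1] (k +ℕ i) (2 *ℕ i))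

evenBinom-pascal : ∀ k i → evenBinom (suc k) (suc i) ≡ oddBinom (suc k) i +ℕ evenBinom k (suc i)
evenBinom-pascal k i = begin
  (suc k +ℕ suc i) C (2 *ℕ suc i)                    ≡⟨ cong₂ _C_ (cong suc (ℕ.+-suc k i)) (ℕ.*-suc 2 i) ⟩
  suc (suc k +ℕ i) C suc (suc (2 *ℕ i))              ≡⟨ nCk+nC[k+1]≡[n+1]C[k+1] (suc k +ℕ i) (suc (2 *ℕ i)) ⟨
  oddBinom (suc k) i +ℕ (suc k +ℕ i) C suc (suc (2 *ℕ i))
    ≡⟨ cong (oddBinom (suc k) i +ℕ_) (cong₂ _C_ (ℕ.+-suc k i) (ℕ.*-suc 2 i)) ⟨
  oddBinom (suc k) i +ℕ evenBinom k (suc i)          ∎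
  where open ≡-Reasoning

-- Absorption gives (2i+1) (C(k+i,2i) + C(k+i,2i+1)) = (k+i+1) C(k+i,2i);
-- double it and cancel (2i+1) C(k+i,2i).
integral-weight : ∀ k i → suc (2 *ℕ i) *ℕ (evenBinom k i +ℕ (oddBinom k i +ℕ oddBinom k i))
                          ≡ suc (2 *ℕ k) *ℕ evenBinom k i
integral-weight k i = ℕ.+-cancelʳ-≡ _ _ _ (begin
  suc (2 *ℕ i) *ℕ (e +ℕ (c +ℕ c)) +ℕ suc (2 *ℕ i) *ℕ e ≡⟨ double i e c ⟩
  2 *ℕ (suc (2 *ℕ i) *ℕ (e +ℕ c))
    ≡⟨ cong (2 *ℕ_) (trans (cong (suc (2 *ℕ i) *ℕ_) (nCk+nC[k+1]≡[n+1]C[k+1] (k +ℕ i) (2 *ℕ i)))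
                           (absorption (k +ℕ i) (2 *ℕ i))) ⟩
  2 *ℕ (suc (k +ℕ i) *ℕ e)                            ≡⟨ undouble k i e ⟩
  suc (2 *ℕ k) *ℕ e +ℕ suc (2 *ℕ i) *ℕ e              ∎)
  where
  e = evenBinom k i
  c = oddBinom k i
  double : ∀ i e c → suc (2 *ℕ i) *ℕ (e +ℕ (c +ℕ c)) +ℕ suc (2 *ℕ i) *ℕ e ≡ 2 *ℕ (suc (2 *ℕ i) *ℕ (e +ℕ c))
  double = ℕ-Solver.solve-∀
  undouble : ∀ k i e → 2 *ℕ (suc (k +ℕ i) *ℕ e) ≡ suc (2 *ℕ k) *ℕ e +ℕ suc (2 *ℕ i) *ℕ e
  undouble = ℕ-Solver.solve-∀
  open ≡-Reasoning

fromℕ : ℕ → ℚ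
fromℕ n = (+ n) / 1

toℚᵘ-fromℕ : ∀ n → toℚᵘ (fromℕ n) ≃ᵘ mkℚᵘ (+ n) 0
toℚᵘ-fromℕ n = toℚᵘ-fromℚᵘ (mkℚᵘ (+ n) 0)

fromℕ-+ : ∀ m n → fromℕ (m +ℕ n) ≡ fromℕ m + fromℕ n
fromℕ-+ m n = toℚᵘ-injective (begin
  toℚᵘ (fromℕ (m +ℕ n))             ≈⟨ toℚᵘ-fromℕ (m +ℕ n) ⟩
  mkℚᵘ (+ (m +ℕ n)) 0                ≈⟨ *≡* (cong (_*ℤ + 1) numerator) ⟩
  mkℚᵘ (+ m) 0 +ᵘ mkℚᵘ (+ n) 0       ≈⟨ ℚᵘ.+-cong (toℚᵘ-fromℕ m) (toℚᵘ-fromℕ n) ⟨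
  toℚᵘ (fromℕ m) +ᵘ toℚᵘ (fromℕ n)   ≈⟨ toℚᵘ-homo-+ (fromℕ m) (fromℕ n) ⟨
  toℚᵘ (fromℕ m + fromℕ n)           ∎)
  where
  open ℚᵘ.≃-Reasoning
  numerator : + (m +ℕ n) ≡ + m *ℤ + 1 +ℤ + n *ℤ + 1
  numerator = trans (ℤ.pos-+ m n) (sym (cong₂ _+ℤ_ (ℤ.*-identityʳ (+ m)) (ℤ.*-identityʳ (+ n))))

fromℕ-exact-/ : ∀ a b d m → suc d *ℕ m ≡ a *ℕ b → ((+ a) / suc d) * fromℕ b ≡ fromℕ m
fromℕ-exact-/ a b d m eq = toℚᵘ-injective (begin
  toℚᵘ (((+ a) / suc d) * fromℕ b)            ≈⟨ toℚᵘ-homo-* ((+ a) / suc d) (fromℕ b) ⟩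
  toℚᵘ ((+ a) / suc d) *ᵘ toℚᵘ (fromℕ b)      ≈⟨ ℚᵘ.*-cong (toℚᵘ-fromℚᵘ (mkℚᵘ (+ a) d)) (toℚᵘ-fromℕ b) ⟩
  mkℚᵘ (+ a) d *ᵘ mkℚᵘ (+ b) 0               ≈⟨ *≡* cross ⟩
  mkℚᵘ (+ m) 0                               ≈⟨ toℚᵘ-fromℕ m ⟨
  toℚᵘ (fromℕ m)                             ∎)
  where
  open ℚᵘ.≃-Reasoning
  cross : (+ a *ℤ + b) *ℤ + 1 ≡ + m *ℤ + suc (d *ℕ 1)
  cross = trans (ℤ.*-identityʳ _) (trans (sym (ℤ.pos-* a b)) (trans (cong +_ ab≡m[1+d]) (ℤ.pos-* m _)))
    where
    ab≡m[1+d] : a *ℕ b ≡ m *ℕ suc (d *ℕ 1)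
    ab≡m[1+d] = trans (sym eq) (trans (ℕ.*-comm (suc d) m) (cong (λ z → m *ℕ suc z) (sym (ℕ.*-identityʳ d))))

ringℚ : ACR.AlmostCommutativeRing 0ℓ 0ℓ
ringℚ = ACR.fromCommutativeRing +-*-commutativeRing (λ x → dec⇒maybe (0ℚ ≟ x))

sumTo-cong : ∀ n {f g : ℕ → ℚ} → (∀ i → i ≤ n → f i ≡ g i) → sumTo n f ≡ sumTo n g
sumTo-cong zero    f≗g = f≗g 0 z≤n
sumTo-cong (suc n) f≗g = cong₂ _+_ (sumTo-cong n (λ i i≤n → f≗g i (ℕ.m≤n⇒m≤1+n i≤n))) (f≗g (suc n) ℕ.≤-refl)

sumTo-+ : ∀ n (f g : ℕ → ℚ) → sumTo n (λ i → f i + g i) ≡ sumTo n f + sumTo n g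
sumTo-+ zero    f g = refl
sumTo-+ (suc n) f g = trans (cong (_+ (f (suc n) + g (suc n))) (sumTo-+ n f g)) (interchange (sumTo n f) (sumTo n g) (f (suc n)) (g (suc n)))
  where
  interchange : ∀ a b c d → (a + b) + (c + d) ≡ (a + c) + (b + d)
  interchange = solve-∀ ringℚ

*-distribˡ-sumTo : ∀ n c (f : ℕ → ℚ) → sumTo n (λ i → c * f i) ≡ c * sumTo n f
*-distribˡ-sumTo zero    c f = refl
*-distribˡ-sumTo (suc n) c f =
  trans (cong (_+ c * f (suc n)) (*-distribˡ-sumTo n c f)) (sym (ℚ.*-distribˡ-+ c _ _))

sumTo-shift : ∀ n (f : ℕ → ℚ) → sumTo (suc n) f ≡ f 0 + sumTo n (λ i → f (suc i))
sumTo-shift zero    f = refl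
sumTo-shift (suc n) f = trans (cong (_+ f (suc (suc n))) (sumTo-shift n f)) (ℚ.+-assoc (f 0) (sumTo n (λ i → f (suc i))) (f (suc (suc n))))

^ℚ-double : ∀ x n → x ^ℚ (2 *ℕ n) ≡ (x * x) ^ℚ n
^ℚ-double x zero    = refl
^ℚ-double x (suc n) = begin
  x ^ℚ (2 *ℕ suc n)            ≡⟨ cong (x ^ℚ_) (ℕ.*-suc 2 n) ⟩
  x * (x * x ^ℚ (2 *ℕ n))      ≡⟨ ℚ.*-assoc x x _ ⟨
  (x * x) * x ^ℚ (2 *ℕ n)      ≡⟨ cong ((x * x) *_) (^ℚ-double x n) ⟩
  (x * x) * (x * x) ^ℚ n       ∎
  where open ≡-Reasoning

geom : ℚ → ℕ → ℚ
geom x zero    = 0ℚ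
geom x (suc n) = 1ℚ + x * geom x n

geom-telescope : ∀ x n → x ^ℚ n + (1ℚ - x) * geom x n ≡ 1ℚ
geom-telescope x zero    = base x
  where
  base : ∀ x → 1ℚ + (1ℚ - x) * 0ℚ ≡ 1ℚ
  base = solve-∀ ringℚ
geom-telescope x (suc n) = begin
  x * x ^ℚ n + (1ℚ - x) * (1ℚ + x * geom x n) ≡⟨ regroup x (x ^ℚ n) (geom x n) ⟩
  x * (x ^ℚ n + (1ℚ - x) * geom x n) + (1ℚ - x) ≡⟨ cong (λ z → x * z + (1ℚ - x)) (geom-telescope x n) ⟩
  x * 1ℚ + (1ℚ - x)                             ≡⟨ close x ⟩
  1ℚ                                            ∎
  where
  open ≡-Reasoning
  regroup : ∀ x p g → x * p + (1ℚ - x) * (1ℚ + x * g) ≡ x * (p + (1ℚ - x) * g) + (1ℚ - x)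
  regroup = solve-∀ ringℚ
  close : ∀ x → x * 1ℚ + (1ℚ - x) ≡ 1ℚ
  close = solve-∀ ringℚ

geom-double : ∀ x n → geom x (2 *ℕ n) ≡ (1ℚ + x) * geom (x * x) n
geom-double x zero    = base x
  where
  base : ∀ x → 0ℚ ≡ (1ℚ + x) * 0ℚ
  base = solve-∀ ringℚ
geom-double x (suc n) = begin
  geom x (2 *ℕ suc n)                     ≡⟨ cong (geom x) (ℕ.*-suc 2 n) ⟩
  1ℚ + x * (1ℚ + x * geom x (2 *ℕ n))     ≡⟨ cong (λ z → 1ℚ + x * (1ℚ + x * z)) (geom-double x n) ⟩
  1ℚ + x * (1ℚ + x * ((1ℚ + x) * g))      ≡⟨ regroup x g ⟩
  (1ℚ + x) * (1ℚ + x * x * g)             ∎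
  where
  open ≡-Reasoning
  g = geom (x * x) n
  regroup : ∀ x g → 1ℚ + x * (1ℚ + x * ((1ℚ + x) * g)) ≡ (1ℚ + x) * (1ℚ + x * x * g)
  regroup = solve-∀ ringℚ

module Homogeneous (x y : ℚ) where

  monomial : (ℕ → ℕ) → ℕ → ℕ → ℚ
  monomial c k i = fromℕ (c i) * x ^ℚ (k ∸ i) * y ^ℚ i

  hsum : (ℕ → ℕ) → ℕ → ℚ
  hsum c k = sumTo k (monomial c k)

  hsum-split : ∀ a b {c} k → (∀ i → c i ≡ a i +ℕ b i) → hsum c k ≡ hsum a k + hsum b k
  hsum-split a b {c} k c≗a+b = trans (sumTo-cong k (λ i _ → split i)) (sumTo-+ k (monomial a k) (monomial b k))
    where
    distrib : ∀ a b p q → (a + b) * p * q ≡ a * p * q + b * p * q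
    distrib = solve-∀ ringℚ
    split : ∀ i → monomial c k i ≡ monomial a k i + monomial b k i
    split i = trans (cong (λ z → z * x ^ℚ (k ∸ i) * y ^ℚ i) (trans (cong fromℕ (c≗a+b i)) (fromℕ-+ (a i) (b i))))
                    (distrib (fromℕ (a i)) (fromℕ (b i)) (x ^ℚ (k ∸ i)) (y ^ℚ i))

  hsum-shift : ∀ c k → hsum c (suc k) ≡ fromℕ (c 0) * x ^ℚ suc k + y * hsum (λ i → c (suc i)) k
  hsum-shift c k = begin
    hsum c (suc k)                                           ≡⟨ sumTo-shift k (monomial c (suc k)) ⟩
    monomial c (suc k) 0 + sumTo k (λ i → monomial c (suc k) (suc i))
      ≡⟨ cong₂ _+_ (ℚ.*-identityʳ (fromℕ (c 0) * x ^ℚ suc k)) (sumTo-cong k (λ i _ → shift-monomial i)) ⟩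
    fromℕ (c 0) * x ^ℚ suc k + sumTo k (λ i → y * monomial (λ i → c (suc i)) k i)
      ≡⟨ cong (_+_ (fromℕ (c 0) * x ^ℚ suc k)) (*-distribˡ-sumTo k y _) ⟩
    fromℕ (c 0) * x ^ℚ suc k + y * hsum (λ i → c (suc i)) k  ∎
    where
    open ≡-Reasoning
    pull-y : ∀ a p y q → a * p * (y * q) ≡ y * (a * p * q)
    pull-y = solve-∀ ringℚ
    shift-monomial : ∀ i → monomial c (suc k) (suc i) ≡ y * monomial (λ i → c (suc i)) k i
    shift-monomial i = pull-y (fromℕ (c (suc i))) (x ^ℚ (k ∸ i)) y (y ^ℚ i)

  hsum-suc : ∀ c k → c (suc k) ≡ 0 → hsum c (suc k) ≡ x * hsum c k
  hsum-suc c k c[1+k]≡0 = begin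
    sumTo k (monomial c (suc k)) + fromℕ (c (suc k)) * x ^ℚ (k ∸ k) * y ^ℚ suc k
      ≡⟨ cong (λ z → sumTo k (monomial c (suc k)) + fromℕ z * x ^ℚ (k ∸ k) * y ^ℚ suc k) c[1+k]≡0 ⟩
    sumTo k (monomial c (suc k)) + fromℕ 0 * x ^ℚ (k ∸ k) * y ^ℚ suc k
      ≡⟨ drop-zero (sumTo k (monomial c (suc k))) (x ^ℚ (k ∸ k)) (y ^ℚ suc k) ⟩
    sumTo k (monomial c (suc k))         ≡⟨ sumTo-cong k pull-x ⟩
    sumTo k (λ i → x * monomial c k i)   ≡⟨ *-distribˡ-sumTo k x (monomial c k) ⟩
    x * hsum c k                         ∎
    where
    open ≡-Reasoning
    drop-zero : ∀ s p q → s + 0ℚ * p * q ≡ s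
    drop-zero = solve-∀ ringℚ
    reassoc : ∀ a x p q → a * (x * p) * q ≡ x * (a * p * q)
    reassoc = solve-∀ ringℚ
    pull-x : ∀ i → i ≤ k → monomial c (suc k) i ≡ x * monomial c k i
    pull-x i i≤k = trans (cong (λ n → fromℕ (c i) * x ^ℚ n * y ^ℚ i) (ℕ.+-∸-assoc 1 i≤k))
                         (reassoc (fromℕ (c i)) x (x ^ℚ (k ∸ i)) (y ^ℚ i))

  evenSum oddSum oddSum⁺ : ℕ → ℚ
  evenSum k = hsum (evenBinom k) k
  oddSum  k = hsum (oddBinom k) k
  oddSum⁺ k = hsum (oddBinom (suc k)) k

  oddSum-suc : ∀ k → oddSum (suc k) ≡ x * oddSum⁺ k
  oddSum-suc k = hsum-suc (oddBinom (suc k)) k (oddBinom-vanish (suc k))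

  evenSum-suc : ∀ k → evenSum (suc k) ≡ x * evenSum k + y * oddSum⁺ k
  evenSum-suc k = begin
    evenSum (suc k)                    ≡⟨ hsum-shift (evenBinom (suc k)) k ⟩
    h + y * hsum (λ i → evenBinom (suc k) (suc i)) k
      ≡⟨ cong (λ z → h + y * z) (hsum-split (oddBinom (suc k)) (λ i → evenBinom k (suc i)) k (evenBinom-pascal k)) ⟩
    h + y * (oddSum⁺ k + r)            ≡⟨ regroup h y (oddSum⁺ k) r ⟩
    (h + y * r) + y * oddSum⁺ k        ≡⟨ cong (_+ y * oddSum⁺ k) x*evenSum ⟨
    x * evenSum k + y * oddSum⁺ k      ∎
    where
    open ≡-Reasoning
    h = fromℕ 1 * x ^ℚ suc k
    r = hsum (λ i → evenBinom k (suc i)) k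
    regroup : ∀ h y o r → h + y * (o + r) ≡ (h + y * r) + y * o
    regroup = solve-∀ ringℚ
    x*evenSum : x * evenSum k ≡ h + y * r
    x*evenSum = trans (sym (hsum-suc (evenBinom k) k (evenBinom-vanish k))) (hsum-shift (evenBinom k) k)

  oddSum⁺-suc : ∀ k → oddSum⁺ (suc k) ≡ x * oddSum⁺ k + evenSum (suc k)
  oddSum⁺-suc k = begin
    oddSum⁺ (suc k)                                   ≡⟨ hsum-split (evenBinom (suc k)) (oddBinom (suc k)) (suc k) (oddBinom-pascal (suc k)) ⟩
    evenSum (suc k) + hsum (oddBinom (suc k)) (suc k) ≡⟨ cong (_+_ (evenSum (suc k))) (oddSum-suc k) ⟩
    evenSum (suc k) + x * oddSum⁺ k                   ≡⟨ ℚ.+-comm (evenSum (suc k)) _ ⟩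
    x * oddSum⁺ k + evenSum (suc k)                   ∎
    where open ≡-Reasoning

summand : ℚ → ℕ → ℕ → ℚ
summand t k i = ((+ suc (2 *ℕ k)) / suc (2 *ℕ i)) * fromℕ (evenBinom k i) * t ^ℚ (k ∸ i) * (1ℚ - t) ^ℚ suc (2 *ℕ i)

module _ (t : ℚ) where

  open Homogeneous t ((1ℚ - t) * (1ℚ - t))

  evenSum-closed : ∀ k → evenSum k ≡ geom (t * t) (suc k) - t * geom (t * t) k
  oddSum⁺-closed : ∀ k → oddSum⁺ k ≡ geom (t * t) (suc k)

  evenSum-closed zero    = base t
    where
    base : ∀ t → 1ℚ ≡ (1ℚ + t * t * 0ℚ) - t * 0ℚ
    base = solve-∀ ringℚ
  evenSum-closed (suc k) = begin
    evenSum (suc k)                                       ≡⟨ evenSum-suc k ⟩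
    t * evenSum k + (1ℚ - t) * (1ℚ - t) * oddSum⁺ k
      ≡⟨ cong₂ (λ e o → t * e + (1ℚ - t) * (1ℚ - t) * o) (evenSum-closed k) (oddSum⁺-closed k) ⟩
    t * (g₁ - t * g) + (1ℚ - t) * (1ℚ - t) * g₁          ≡⟨ step t g ⟩
    geom (t * t) (suc (suc k)) - t * g₁                   ∎
    where
    open ≡-Reasoning
    g  = geom (t * t) k
    g₁ = geom (t * t) (suc k)
    step : ∀ t g → t * ((1ℚ + t * t * g) - t * g) + (1ℚ - t) * (1ℚ - t) * (1ℚ + t * t * g)
                   ≡ (1ℚ + t * t * (1ℚ + t * t * g)) - t * (1ℚ + t * t * g)
    step = solve-∀ ringℚ

  oddSum⁺-closed zero    = base t
    where
    base : ∀ t → 1ℚ ≡ 1ℚ + t * t * 0ℚ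
    base = solve-∀ ringℚ
  oddSum⁺-closed (suc k) = begin
    oddSum⁺ (suc k)                                 ≡⟨ oddSum⁺-suc k ⟩
    t * oddSum⁺ k + evenSum (suc k)                 ≡⟨ cong₂ (λ o e → t * o + e) (oddSum⁺-closed k) (evenSum-closed (suc k)) ⟩
    t * g₁ + (g₂ - t * g₁)                          ≡⟨ cancel (t * g₁) g₂ ⟩
    g₂                                              ∎
    where
    open ≡-Reasoning
    g₁ = geom (t * t) (suc k)
    g₂ = geom (t * t) (suc (suc k))
    cancel : ∀ a b → a + (b - a) ≡ b
    cancel = solve-∀ ringℚ

  oddSum-closed : ∀ k → oddSum k ≡ t * geom (t * t) k
  oddSum-closed zero    = sym (ℚ.*-zeroʳ t)
  oddSum-closed (suc k) = trans (oddSum-suc k) (cong (t *_) (oddSum⁺-closed k))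

  evenSum+2*oddSum : ∀ k → evenSum k + (oddSum k + oddSum k) ≡ geom t (suc (2 *ℕ k))
  evenSum+2*oddSum k = begin
    evenSum k + (oddSum k + oddSum k)
      ≡⟨ cong₂ (λ e o → e + (o + o)) (evenSum-closed k) (oddSum-closed k) ⟩
    ((1ℚ + t * t * g) - t * g) + (t * g + t * g)    ≡⟨ regroup t g ⟩
    1ℚ + t * ((1ℚ + t) * g)                         ≡⟨ cong (λ z → 1ℚ + t * z) (geom-double t k) ⟨
    geom t (suc (2 *ℕ k))                           ∎
    where
    open ≡-Reasoning
    g = geom (t * t) k
    regroup : ∀ t g → ((1ℚ + t * t * g) - t * g) + (t * g + t * g) ≡ 1ℚ + t * ((1ℚ + t) * g)
    regroup = solve-∀ ringℚ

  summand-factor : ∀ k i → summand t k i ≡ (1ℚ - t) * monomial (λ i → evenBinom k i +ℕ (oddBinom k i +ℕ oddBinom k i)) k i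
  summand-factor k i = begin
    summand t k i
      ≡⟨ cong₂ (λ a p → a * t ^ℚ (k ∸ i) * ((1ℚ - t) * p))
               (fromℕ-exact-/ (suc (2 *ℕ k)) e (2 *ℕ i) (e +ℕ (c +ℕ c)) (integral-weight k i))
               (^ℚ-double (1ℚ - t) i) ⟩
    fromℕ (e +ℕ (c +ℕ c)) * t ^ℚ (k ∸ i) * ((1ℚ - t) * ((1ℚ - t) * (1ℚ - t)) ^ℚ i)
      ≡⟨ pull-s (fromℕ (e +ℕ (c +ℕ c))) (t ^ℚ (k ∸ i)) (1ℚ - t) (((1ℚ - t) * (1ℚ - t)) ^ℚ i) ⟩
    (1ℚ - t) * (fromℕ (e +ℕ (c +ℕ c)) * t ^ℚ (k ∸ i) * ((1ℚ - t) * (1ℚ - t)) ^ℚ i) ∎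
    where
    open ≡-Reasoning
    e = evenBinom k i
    c = oddBinom k i
    pull-s : ∀ a p s q → a * p * (s * q) ≡ s * (a * p * q)
    pull-s = solve-∀ ringℚ

  sumTo-summand : ∀ k → sumTo k (summand t k) ≡ (1ℚ - t) * (evenSum k + (oddSum k + oddSum k))
  sumTo-summand k = begin
    sumTo k (summand t k)                       ≡⟨ sumTo-cong k (λ i _ → summand-factor k i) ⟩
    sumTo k (λ i → (1ℚ - t) * monomial c k i)   ≡⟨ *-distribˡ-sumTo k (1ℚ - t) (monomial c k) ⟩
    (1ℚ - t) * hsum c k
      ≡⟨ cong ((1ℚ - t) *_) (hsum-split (evenBinom k) (λ i → oddBinom k i +ℕ oddBinom k i) k (λ _ → refl)) ⟩
    (1ℚ - t) * (evenSum k + hsum (λ i → oddBinom k i +ℕ oddBinom k i) k)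
      ≡⟨ cong (λ z → (1ℚ - t) * (evenSum k + z)) (hsum-split (oddBinom k) (oddBinom k) k (λ _ → refl)) ⟩
    (1ℚ - t) * (evenSum k + (oddSum k + oddSum k)) ∎
    where
    open ≡-Reasoning
    c = λ i → evenBinom k i +ℕ (oddBinom k i +ℕ oddBinom k i)

lemma8p2 : (k : ℕ) (t : ℚ) →
    (t ^ℚ suc (2 *ℕ k)) +
      sumTo k (λ i → ((+ suc (2 *ℕ k)) / suc (2 *ℕ i)) * ((+ ((k +ℕ i) C (2 *ℕ i))) / 1)
                      * (t ^ℚ (k ∸ i)) * ((1ℚ - t) ^ℚ suc (2 *ℕ i)))
      ≡ 1ℚ
lemma8p2 k t = begin
  t ^ℚ n + sumTo k (summand t k)                           ≡⟨ cong (_+_ (t ^ℚ n)) (sumTo-summand t k) ⟩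
  t ^ℚ n + (1ℚ - t) * (evenSum k + (oddSum k + oddSum k))  ≡⟨ cong (λ z → t ^ℚ n + (1ℚ - t) * z) (evenSum+2*oddSum t k) ⟩
  t ^ℚ n + (1ℚ - t) * geom t n                             ≡⟨ geom-telescope t n ⟩
  1ℚ                                                       ∎
  where
  open ≡-Reasoning
  open Homogeneous t ((1ℚ - t) * (1ℚ - t))
  n = suc (2 *ℕ k)
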